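{- Let $G=(V,E)$ be a graph, $a$ a positive integer and $V_D'\subseteq V$. Let $S_1,\ldots,S_k$ be disjoint vertex sets such that for each $u\in V_D'$, either $N^a(u)\subseteq S_i$ for some $1\le i\le k$, or $N^a(u)\cap(S_1\cup\cdots\cup S_k)=\emptyset$. Define $S=\{v\in V:\operatorname{dist}(v,\bigcup_{i=1}^k S_i)\le a\}$. If $G[S]$ is connected, then (1) $N_S=\sum_{i=1}^k N_{S_i}$, and (2) $D_S\le -1+\sum_{i=1}^k(D_{S_i}+2a+1)$.
   Context: Distances $\operatorname{dist}$ are in $G$; $N^a(u)=\{w\in V:\operatorname{dist}(u,w)\le a\}$; $G[X]$ is the subgraph induced by $X$. For a vertex set $X$: $N_X$ is the maximum size of a subset $X^\ast\subseteq X\cap V_D'$ such that $\operatorname{dist}(u,v)>2a$ for every pair of distinct $u,v\in X^\ast$; and $D_X$ is the diameter of $G[X]$. -}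

module Defs where

open import Data.Nat using (ℕ; zero; suc; _+_; _*_; _≤_; _>_)
open import Data.Fin using (Fin; zero; suc)
open import Data.Fin.Subset using (Subset; _∈_; ∣_∣)
open import Data.Product using (Σ; ∃; _×_; _,_)
open import Relation.Nullary using (¬_)
open import Relation.Binary.PropositionalEquality using (_≡_)
open import Data.Empty using (⊥)
open import Data.Unit using (⊤)

record Graph (n : ℕ) : Set₁ where
  field
    Adj     : Fin n → Fin n → Set
    sym     : ∀ {u v} → Adj u v → Adj v u
    irrefl  : ∀ {u} → ¬ Adj u u

VSet : ℕ → Set₁
VSet n = Fin n → Set

module _ {n : ℕ} (G : Graph n) where
  open Graph G

  data Walk (P : VSet n) : Fin n → Fin n → ℕ → Set where
    here : ∀ {u} → P u → Walk P u u 0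
    step : ∀ {u w v l} → P u → Adj u w → Walk P w v l → Walk P u v (suc l)

  Everything : VSet n
  Everything _ = ⊤

  DistLe : Fin n → Fin n → ℕ → Set
  DistLe u v d = Σ ℕ λ l → l ≤ d × Walk Everything u v l

  Ball : ℕ → Fin n → VSet n
  Ball a u w = DistLe u w a

  DistSetLe : Fin n → VSet n → ℕ → Set
  DistSetLe v X a = Σ (Fin n) λ w → X w × DistLe v w a

  ConnectedInduced : VSet n → Set
  ConnectedInduced X = ∀ u v → X u → X v → Σ ℕ λ l → Walk X u v l

  -- D_X ≤ d : the diameter of G[X] (distances inside G[X]) is at most d.
  -- (If G[X] is disconnected, D_X = ∞ and no d satisfies this.)
  DiamLe : VSet n → ℕ → Set
  DiamLe X d = ∀ u v → X u → X v → Σ ℕ λ l → l ≤ d × Walk X u v l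

  -- Y is an admissible set for N_X: Y ⊆ X ∩ V_D' and pairwise dist > 2a.
  Packing : ℕ → VSet n → VSet n → Subset n → Set
  Packing a VD' X Y =
    (∀ v → v ∈ Y → X v × VD' v) ×
    (∀ u v → u ∈ Y → v ∈ Y → ¬ (u ≡ v) → ¬ DistLe u v (2 * a))

  IsN : ℕ → VSet n → VSet n → ℕ → Set
  IsN a VD' X m =
    (Σ (Subset n) λ Y → Packing a VD' X Y × ∣ Y ∣ ≡ m) ×
    (∀ Y → Packing a VD' X Y → ∣ Y ∣ ≤ m)

sumFin : ∀ k → (Fin k → ℕ) → ℕ
sumFin zero    f = 0
sumFin (suc k) f = f zero + sumFin k (λ i → f (suc i))

module Submission where

-- A vertex of V_D' ∩ S sees U within distance a, so its
--     ball lies in some Sᵢ and it belongs to that Sᵢ; two vertices of V_D' lying in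
--     different Sᵢ, Sⱼ are more than 2a apart (a walk of length ≤ 2a has a midpoint
--     in both balls, contradicting disjointness).  Hence a packing of S splits into
--     packings of the Sᵢ, and the union of packings of the Sᵢ is a packing of S.  We prove a general compression lemma:
--     if the vertices of X carry labels in Fin k and two vertices with label i are
--     always joined inside X by a walk shorter than cᵢ, then every walk in X can be
--     replaced by one shorter than Σ cᵢ, each label being "paid for" at most once.
--     In S, label a vertex by an Sᵢ within distance a; equal labels are joined
--     through Sᵢ by a walk of length ≤ a + D_{Sᵢ} + a < D_{Sᵢ} + 2a + 1.

open import Defs
open import Data.Nat using (ℕ; zero; suc; _+_; _*_; _∸_; _≤_; _<_; z≤n; s≤s; _≤?_)
open import Data.Nat.Properties hiding (_≟_; suc-injective)
open import Data.Nat.Solver using (module +-*-Solver)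
open import Data.Fin using (Fin; zero; suc)
open import Data.Fin.Properties using (_≟_; suc-injective)
open import Data.Fin.Subset
  using (Subset; inside; outside; _∈_; _⊆_; _∪_; _∩_; ∣_∣)
  renaming (⊥ to ∅)
open import Data.Fin.Subset.Properties
  using (x∈p∩q⁻; x∈p∪q⁻; p⊆p∪q; q⊆p∪q; ∉⊥; Empty-unique; ∣⊥∣≡0; p⊆q⇒∣p∣≤∣q∣)
open import Data.Vec.Base using ([]; _∷_; here; there)
open import Data.Bool using (Bool; true; false; if_then_else_)
open import Data.List using (List; []; _∷_)
open import Data.List.Relation.Unary.Any using (here; there)
open import Data.Product using (Σ; _×_; _,_; proj₁; proj₂)
open import Data.Sum using (_⊎_; inj₁; inj₂)
open import Data.Empty using (⊥; ⊥-elim)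
open import Data.Unit using (tt)
open import Function using (case_of_)
open import Relation.Nullary using (¬_; yes; no; does)
open import Relation.Nullary.Decidable using (dec-true; dec-false)
open import Relation.Binary.PropositionalEquality
  using (_≡_; _≢_; refl; sym; trans; cong; cong₂; subst; module ≡-Reasoning)
open import Algebra.Properties.CommutativeSemigroup +-commutativeSemigroup
  using (x∙yz≈y∙xz)

sumFin-cong : ∀ k {f g : Fin k → ℕ} → (∀ i → f i ≡ g i) → sumFin k f ≡ sumFin k g
sumFin-cong zero    f≡g = refl
sumFin-cong (suc k) f≡g = cong₂ _+_ (f≡g zero) (sumFin-cong k (λ i → f≡g (suc i)))

sumFin-mono : ∀ k {f g : Fin k → ℕ} → (∀ i → f i ≤ g i) → sumFin k f ≤ sumFin k g
sumFin-mono zero    f≤g = z≤n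
sumFin-mono (suc k) f≤g = +-mono-≤ (f≤g zero) (sumFin-mono k (λ i → f≤g (suc i)))

sumFin-extract : ∀ {k} (t t′ : Fin k → ℕ) (i : Fin k) →
  t′ i ≡ 0 → (∀ j → j ≢ i → t′ j ≡ t j) → sumFin k t ≡ t i + sumFin k t′
sumFin-extract {suc k} t t′ zero t′₀≡0 same rewrite t′₀≡0 =
  cong (t zero +_) (sumFin-cong k (λ j → sym (same (suc j) λ ())))
sumFin-extract {suc k} t t′ (suc i) t′ᵢ≡0 same = begin
    t zero + sumFin k (λ j → t (suc j))
  ≡⟨ cong (t zero +_) (sumFin-extract (λ j → t (suc j)) (λ j → t′ (suc j)) i t′ᵢ≡0
                         (λ j j≢i → same (suc j) (λ { refl → j≢i refl }))) ⟩
    t zero + (t (suc i) + rest)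
  ≡⟨ x∙yz≈y∙xz (t zero) (t (suc i)) rest ⟩
    t (suc i) + (t zero + rest)
  ≡⟨ cong (λ x → t (suc i) + (x + rest)) (sym (same zero λ ())) ⟩
    t (suc i) + (t′ zero + rest)
  ∎
  where
  open ≡-Reasoning
  rest = sumFin k (λ j → t′ (suc j))

∣p∪q∣+∣p∩q∣ : ∀ {n} (p q : Subset n) → ∣ p ∪ q ∣ + ∣ p ∩ q ∣ ≡ ∣ p ∣ + ∣ q ∣
∣p∪q∣+∣p∩q∣ []            []            = refl
∣p∪q∣+∣p∩q∣ (inside ∷ p)  (inside ∷ q)  =
  cong suc (trans (+-suc _ _) (trans (cong suc (∣p∪q∣+∣p∩q∣ p q)) (sym (+-suc _ _))))
∣p∪q∣+∣p∩q∣ (inside ∷ p)  (outside ∷ q) = cong suc (∣p∪q∣+∣p∩q∣ p q)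
∣p∪q∣+∣p∩q∣ (outside ∷ p) (inside ∷ q)  = trans (cong suc (∣p∪q∣+∣p∩q∣ p q)) (sym (+-suc _ _))
∣p∪q∣+∣p∩q∣ (outside ∷ p) (outside ∷ q) = ∣p∪q∣+∣p∩q∣ p q

⋃ᶠ : ∀ {n k} → (Fin k → Subset n) → Subset n
⋃ᶠ {k = zero}  Ps = ∅
⋃ᶠ {k = suc k} Ps = Ps zero ∪ ⋃ᶠ (λ i → Ps (suc i))

∈⋃ᶠ⁺ : ∀ {n k} (Ps : Fin k → Subset n) i {v} → v ∈ Ps i → v ∈ ⋃ᶠ Ps
∈⋃ᶠ⁺ Ps zero    v∈ = p⊆p∪q _ v∈
∈⋃ᶠ⁺ Ps (suc i) v∈ = q⊆p∪q (Ps zero) _ (∈⋃ᶠ⁺ (λ j → Ps (suc j)) i v∈)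

∈⋃ᶠ⁻ : ∀ {n k} (Ps : Fin k → Subset n) {v} → v ∈ ⋃ᶠ Ps → Σ (Fin k) λ i → v ∈ Ps i
∈⋃ᶠ⁻ {k = zero}  Ps v∈ = ⊥-elim (∉⊥ v∈)
∈⋃ᶠ⁻ {k = suc k} Ps v∈ with x∈p∪q⁻ (Ps zero) _ v∈
... | inj₁ v∈P₀ = zero , v∈P₀
... | inj₂ v∈Ps = let i , v∈Pᵢ = ∈⋃ᶠ⁻ (λ j → Ps (suc j)) v∈Ps in suc i , v∈Pᵢ

⋃ᶠ-subadditive : ∀ {n} k (Ps : Fin k → Subset n) → ∣ ⋃ᶠ Ps ∣ ≤ sumFin k (λ i → ∣ Ps i ∣)
⋃ᶠ-subadditive {n} zero Ps = ≤-reflexive (∣⊥∣≡0 n)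
⋃ᶠ-subadditive (suc k) Ps = begin
  ∣ Ps zero ∪ R ∣                    ≤⟨ m≤m+n _ _ ⟩
  ∣ Ps zero ∪ R ∣ + ∣ Ps zero ∩ R ∣  ≡⟨ ∣p∪q∣+∣p∩q∣ (Ps zero) R ⟩
  ∣ Ps zero ∣ + ∣ R ∣                ≤⟨ +-monoʳ-≤ ∣ Ps zero ∣ (⋃ᶠ-subadditive k (λ i → Ps (suc i))) ⟩
  ∣ Ps zero ∣ + sumFin k (λ i → ∣ Ps (suc i) ∣) ∎
  where
  open ≤-Reasoning
  R = ⋃ᶠ (λ i → Ps (suc i))

Disjoint : ∀ {n k} → (Fin k → Subset n) → Set
Disjoint Ps = ∀ i j {v} → v ∈ Ps i → v ∈ Ps j → i ≡ j

⋃ᶠ-additive : ∀ {n} k (Ps : Fin k → Subset n) → Disjoint Ps →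
  ∣ ⋃ᶠ Ps ∣ ≡ sumFin k (λ i → ∣ Ps i ∣)
⋃ᶠ-additive {n} zero Ps disj = ∣⊥∣≡0 n
⋃ᶠ-additive {n} (suc k) Ps disj = begin
  ∣ Ps zero ∪ R ∣                    ≡⟨ sym (+-identityʳ _) ⟩
  ∣ Ps zero ∪ R ∣ + 0                ≡⟨ cong (∣ Ps zero ∪ R ∣ +_) (sym ∣P₀∩R∣≡0) ⟩
  ∣ Ps zero ∪ R ∣ + ∣ Ps zero ∩ R ∣  ≡⟨ ∣p∪q∣+∣p∩q∣ (Ps zero) R ⟩
  ∣ Ps zero ∣ + ∣ R ∣                ≡⟨ cong (∣ Ps zero ∣ +_) (⋃ᶠ-additive k _ disjoint-tail) ⟩
  ∣ Ps zero ∣ + sumFin k (λ i → ∣ Ps (suc i) ∣) ∎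
  where
  open ≡-Reasoning
  R = ⋃ᶠ (λ i → Ps (suc i))
  disjoint-tail : Disjoint (λ i → Ps (suc i))
  disjoint-tail i j v∈Pᵢ v∈Pⱼ = suc-injective (disj (suc i) (suc j) v∈Pᵢ v∈Pⱼ)
  ∣P₀∩R∣≡0 : ∣ Ps zero ∩ R ∣ ≡ 0
  ∣P₀∩R∣≡0 = trans (cong ∣_∣ (Empty-unique λ (v , v∈) →
    let v∈P₀ , v∈R = x∈p∩q⁻ (Ps zero) R v∈
        i , v∈Pᵢ = ∈⋃ᶠ⁻ (λ j → Ps (suc j)) v∈R
    in case disj zero (suc i) v∈P₀ v∈Pᵢ of λ ())) (∣⊥∣≡0 n)

cover-bound : ∀ {n} k (Y : Subset n) (Ys : Fin k → Subset n) →
  (∀ {v} → v ∈ Y → Σ (Fin k) λ i → v ∈ Ys i) → ∣ Y ∣ ≤ sumFin k (λ i → ∣ Ys i ∣)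
cover-bound k Y Ys cover =
  ≤-trans (p⊆q⇒∣p∣≤∣q∣ (λ v∈Y → let i , v∈Yᵢ = cover v∈Y in ∈⋃ᶠ⁺ Ys i v∈Yᵢ))
          (⋃ᶠ-subadditive k Ys)

Classification : ∀ {n k} → (Fin k → Fin n → Set) → Subset n → Set
Classification {n} {k} P Y = Σ (Fin k → Subset n) λ Ys →
  (∀ {v} → v ∈ Y → Σ (Fin k) λ i → v ∈ Ys i) ×
  (∀ i → Ys i ⊆ Y) ×
  (∀ i {v} → v ∈ Ys i → P i v)

classify : ∀ {n k} (P : Fin k → Fin n → Set) (Y : Subset n) →
  (∀ {v} → v ∈ Y → Σ (Fin k) λ i → P i v) → Classification P Y
classify P []            choice = (λ _ → []) , (λ ()) , (λ _ ()) , (λ _ ())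
classify P (outside ∷ Y) choice
  with classify (λ i v → P i (suc v)) Y (λ v∈Y → choice (there v∈Y))
... | Ys , cover , Ys⊆Y , sorted = (λ i → outside ∷ Ys i) , cover′ , Ys′⊆Y′ , sorted′
  where
  cover′ : ∀ {v} → v ∈ outside ∷ Y → Σ _ λ i → v ∈ outside ∷ Ys i
  cover′ (there v∈Y) = let i , v∈Yᵢ = cover v∈Y in i , there v∈Yᵢ
  Ys′⊆Y′ : ∀ i → outside ∷ Ys i ⊆ outside ∷ Y
  Ys′⊆Y′ i (there v∈Yᵢ) = there (Ys⊆Y i v∈Yᵢ)
  sorted′ : ∀ i {v} → v ∈ outside ∷ Ys i → P i v
  sorted′ i (there v∈Yᵢ) = sorted i v∈Yᵢ
classify P (inside ∷ Y)  choice
  with classify (λ i v → P i (suc v)) Y (λ v∈Y → choice (there v∈Y))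
... | Ys , cover , Ys⊆Y , sorted = Ys′ , cover′ , Ys′⊆Y′ , sorted′
  where
  j = proj₁ (choice here)
  Ys′ : Fin _ → Subset _
  Ys′ i = does (i ≟ j) ∷ Ys i
  cover′ : ∀ {v} → v ∈ inside ∷ Y → Σ _ λ i → v ∈ Ys′ i
  cover′ here         = j , subst (λ b → zero ∈ b ∷ Ys j) (sym (dec-true (j ≟ j) refl)) here
  cover′ (there v∈Y)  = let i , v∈Yᵢ = cover v∈Y in i , there v∈Yᵢ
  Ys′⊆Y′ : ∀ i → Ys′ i ⊆ inside ∷ Y
  Ys′⊆Y′ i {zero} _       = here
  Ys′⊆Y′ i (there v∈Yᵢ)   = there (Ys⊆Y i v∈Yᵢ)
  sorted′ : ∀ i {v} → v ∈ Ys′ i → P i v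
  sorted′ i {zero} zero∈ with i ≟ j | zero∈
  ... | yes refl | _ = proj₂ (choice here)
  ... | no  _    | ()
  sorted′ i (there v∈Yᵢ)  = sorted i v∈Yᵢ

module Walks {n : ℕ} (G : Graph n) where
  open Graph G using (Adj) renaming (sym to Adj-sym)

  walk-start : ∀ {P u v l} → Walk G P u v l → P u
  walk-start (here pu)     = pu
  walk-start (step pu _ _) = pu

  widen : ∀ {P Q : VSet n} → (∀ x → P x → Q x) → ∀ {u v l} → Walk G P u v l → Walk G Q u v l
  widen P⊆Q (here pu)        = here (P⊆Q _ pu)
  widen P⊆Q (step pu uw rest) = step (P⊆Q _ pu) uw (widen P⊆Q rest)

  _++ʷ_ : ∀ {P u v w l m} → Walk G P u v l → Walk G P v w m → Walk G P u w (l + m)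
  here _          ++ʷ W = W
  step pu uw rest ++ʷ W = step pu uw (rest ++ʷ W)

  extend : ∀ {P u v w l} → Walk G P u v l → Adj v w → P w → Walk G P u w (suc l)
  extend (here pu)          vw pw = step pu vw (here pw)
  extend (step pu ux rest)  vw pw = step pu ux (extend rest vw pw)

  reverse : ∀ {P u v l} → Walk G P u v l → Walk G P v u l
  reverse (here pu)          = here pu
  reverse (step pu uw rest)  = extend (reverse rest) (Adj-sym uw) pu

  splitAt : ∀ {P u v} l m → Walk G P u v (l + m) → Σ (Fin n) λ x → Walk G P u x l × Walk G P x v m
  splitAt zero    m W                 = _ , here (walk-start W) , W
  splitAt (suc l) m (step pu uw rest) =
    let x , W₁ , W₂ = splitAt l m rest in x , step pu uw W₁ , W₂

  DistLe-sym : ∀ {u v d} → DistLe G u v d → DistLe G v u d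
  DistLe-sym (l , l≤d , W) = l , l≤d , reverse W

  midpoint : ∀ {u v} b c → DistLe G u v (b + c) →
    Σ (Fin n) λ x → DistLe G u x b × DistLe G x v c
  midpoint b c (l , l≤b+c , W) with l ≤? b
  ... | yes l≤b = _ , (l , l≤b , W) , (0 , z≤n , here tt)
  ... | no  l≰b =
    let x , W₁ , W₂ = splitAt b (l ∸ b) (subst (Walk G _ _ _) (sym (m+[n∸m]≡n b≤l)) W)
    in x , (b , ≤-refl , W₁) , (l ∸ b , m≤n+o⇒m∸n≤o l b l≤b+c , W₂)
    where b≤l = ≰⇒≥ l≰b

  near-walk : ∀ {U : VSet n} {a x w l} → Walk G (Everything G) x w l → l ≤ a → U w →
    Walk G (λ v → DistSetLe G v U a) x w l
  near-walk (here _)           l≤a w∈U = here (_ , w∈U , (0 , z≤n , here tt))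
  near-walk (step t xy rest)   l≤a w∈U =
    step (_ , w∈U , (_ , l≤a , step t xy rest)) xy (near-walk rest (≤-trans (n≤1+n _) l≤a) w∈U)

-- A walk is compressed greedily: from the current vertex, jump to the last
-- vertex of the walk carrying the same label, step once, and continue; each label
-- is used for at most one jump, so the result is shorter than Σ c.
module Compression {n k : ℕ} (G : Graph n) (X : VSet n)
  (label : ∀ {x} → X x → Fin k) (c : Fin k → ℕ)
  (shortcut : ∀ {x y} (px : X x) (py : X y) → label px ≡ label py →
              Σ ℕ λ l → l < c (label px) × Walk G X x y l) where
  open Walks G
  open import Data.List.Membership.DecPropositional (_≟_ {k})
    using () renaming (_∈_ to _∈ˡ_; _∈?_ to _∈ˡ?_)

  -- Sets of labels still available, and the total budget they provide.
  cost : (Fin k → Bool) → ℕ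
  cost A = sumFin k (λ i → if A i then c i else 0)

  _∖_ : (Fin k → Bool) → Fin k → (Fin k → Bool)
  (A ∖ i) j = if does (j ≟ i) then false else A j

  ∖-keeps : ∀ A i j → j ≢ i → A j ≡ true → (A ∖ i) j ≡ true
  ∖-keeps A i j j≢i Aⱼ rewrite dec-false (j ≟ i) j≢i = Aⱼ

  cost-∖ : ∀ A i → A i ≡ true → cost A ≡ c i + cost (A ∖ i)
  cost-∖ A i Aᵢ =
    trans (sumFin-extract _ _ i removed kept) (cong (λ b → (if b then c i else 0) + cost (A ∖ i)) Aᵢ)
    where
    removed : (if (A ∖ i) i then c i else 0) ≡ 0
    removed rewrite dec-true (i ≟ i) refl = refl
    kept : ∀ j → j ≢ i → (if (A ∖ i) j then c j else 0) ≡ (if A j then c j else 0)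
    kept j j≢i rewrite dec-false (j ≟ i) j≢i = refl

  c≤cost : ∀ A i → A i ≡ true → c i ≤ cost A
  c≤cost A i Aᵢ = ≤-trans (m≤m+n _ _) (≤-reflexive (sym (cost-∖ A i Aᵢ)))

  labels : ∀ {x y l} → Walk G X x y l → List (Fin k)
  labels (here px)       = label px ∷ []
  labels (step px _ W)   = label px ∷ labels W

  start∈labels : ∀ {x y l} (W : Walk G X x y l) → label (walk-start W) ∈ˡ labels W
  start∈labels (here _)     = here refl
  start∈labels (step _ _ _) = here refl

  compress : ∀ {x y l} (W : Walk G X x y l) (A : Fin k → Bool) →
    (∀ {i} → i ∈ˡ labels W → A i ≡ true) →
    ∀ {z} (pz : X z) → label pz ∈ˡ labels W → Σ ℕ λ l′ → l′ < cost A × Walk G X z y l′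
  compress (here py) A available pz (here same) =
    let s , s<c , Ws = shortcut pz py same
    in s , ≤-trans s<c (c≤cost A _ (available (here same))) , Ws
  compress (step px xw W) A available pz (there z∈W) =
    compress W A (λ i∈W → available (there i∈W)) pz z∈W
  compress (step px xw W) A available pz (here same) with label px ∈ˡ? labels W
  ... | yes x∈W = compress W A (λ i∈W → available (there i∈W)) pz (subst (_∈ˡ labels W) (sym same) x∈W)
  ... | no  x∉W
    with shortcut pz px same
       | compress W (A ∖ label px) still-available (walk-start W) (start∈labels W)
    where
    still-available : ∀ {j} → j ∈ˡ labels W → (A ∖ label px) j ≡ true
    still-available {j} j∈W =
      ∖-keeps A (label px) j (λ j≡x → x∉W (subst (_∈ˡ labels W) j≡x j∈W)) (available (there j∈W))
  ... | s , s<c , Ws | r , r<cost , Wr =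
    s + suc r ,
    subst (s + suc r <_) (sym (cost-∖ A (label px) (available (here refl))))
          (+-mono-≤ (subst (λ i → s < c i) same s<c) r<cost) ,
    Ws ++ʷ step px xw Wr

  compress-walk : ∀ {x y l} → Walk G X x y l → Σ ℕ λ l′ → l′ < sumFin k c × Walk G X x y l′
  compress-walk W = compress W (λ _ → true) (λ _ → refl) (walk-start W) (start∈labels W)

  diameter-bound : ConnectedInduced G X → DiamLe G X (sumFin k c ∸ 1)
  diameter-bound connected u v pu pv =
    let l , W = connected u v pu pv
        l′ , l′<Σc , W′ = compress-walk W
    in l′ , suc[m]≤n⇒m≤pred[n] l′<Σc , W′

packing-restrict : ∀ {n} (G : Graph n) {a : ℕ} {VD' X X′ : VSet n} {Y Z : Subset n} →
  Packing G a VD' X Y → Z ⊆ Y → (∀ {v} → v ∈ Z → X′ v) → Packing G a VD' X′ Z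
packing-restrict G (inY , far) Z⊆Y inX′ =
  (λ v v∈Z → inX′ v∈Z , proj₂ (inY v (Z⊆Y v∈Z))) ,
  (λ u v u∈Z v∈Z → far u v (Z⊆Y u∈Z) (Z⊆Y v∈Z))

module Neighbourhood {n : ℕ} (G : Graph n) (a k : ℕ) (Ss : Fin k → VSet n) where
  open Walks G

  U : VSet n
  U w = Σ (Fin k) λ i → Ss i w

  S : VSet n
  S v = DistSetLe G v U a

  Sᵢ⊆S : ∀ i {x} → Ss i x → S x
  Sᵢ⊆S i x∈Sᵢ = _ , (i , x∈Sᵢ) , (0 , z≤n , here tt)

  class : ∀ {x} → S x → Fin k
  class (_ , (i , _) , _) = i

  private
    detour-length : ∀ d l₁ l₂ l₃ → l₁ ≤ a → l₃ ≤ d → l₂ ≤ a → l₁ + (l₃ + l₂) < d + 2 * a + 1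
    detour-length d l₁ l₂ l₃ l₁≤a l₃≤d l₂≤a =
      ≤-trans (s≤s (+-mono-≤ l₁≤a (+-mono-≤ l₃≤d l₂≤a))) (≤-reflexive (rearrange a d))
      where
      open +-*-Solver
      rearrange : ∀ a d → suc (a + (d + a)) ≡ d + 2 * a + 1
      rearrange = solve 2 (λ a d → con 1 :+ (a :+ (d :+ a)) := d :+ con 2 :* a :+ con 1) refl

  through-class : (ds : Fin k → ℕ) → (∀ i → DiamLe G (Ss i) (ds i)) →
    ∀ {x y} (px : S x) (py : S y) → class px ≡ class py →
    Σ ℕ λ l → l < ds (class px) + 2 * a + 1 × Walk G S x y l
  through-class ds diam (w , (i , w∈Sᵢ) , (l₁ , l₁≤a , W₁)) (w′ , (.i , w′∈Sᵢ) , (l₂ , l₂≤a , W₂)) refl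
    with diam i w w′ w∈Sᵢ w′∈Sᵢ
  ... | l₃ , l₃≤d , W₃ =
    l₁ + (l₃ + l₂) ,
    detour-length (ds i) l₁ l₂ l₃ l₁≤a l₃≤d l₂≤a ,
    near-walk W₁ l₁≤a (i , w∈Sᵢ) ++ʷ (widen (λ _ → Sᵢ⊆S i) W₃ ++ʷ reverse (near-walk W₂ l₂≤a (i , w′∈Sᵢ)))

  diameter : (ds : Fin k → ℕ) → (∀ i → DiamLe G (Ss i) (ds i)) →
    ConnectedInduced G S → DiamLe G S (sumFin k (λ i → ds i + 2 * a + 1) ∸ 1)
  diameter ds diam = Compression.diameter-bound G S class (λ i → ds i + 2 * a + 1) (through-class ds diam)

  module Packings (VD' : VSet n)
    (disjoint : ∀ i j → ¬ (i ≡ j) → ∀ v → Ss i v → Ss j v → ⊥)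
    (alternative : ∀ u → VD' u →
       (Σ (Fin k) λ i → ∀ w → Ball G a u w → Ss i w) ⊎ (∀ w → Ball G a u w → ∀ i → ¬ Ss i w))
    where

    centre : ∀ u → Ball G a u u
    centre u = 0 , z≤n , here tt

    ball-inside : ∀ {u} i → VD' u → Ss i u → ∀ w → Ball G a u w → Ss i w
    ball-inside {u} i u∈D u∈Sᵢ with alternative u u∈D
    ... | inj₂ misses      = ⊥-elim (misses u (centre u) i u∈Sᵢ)
    ... | inj₁ (j , within) with i ≟ j
    ...   | yes refl = within
    ...   | no  i≢j  = ⊥-elim (disjoint i j i≢j u u∈Sᵢ (within u (centre u)))

    -- Vertices of V_D' in different classes are more than 2a apart: a shorter walk
    -- would have a midpoint lying in both a-balls, hence in two of the Sᵢ.
    separated : ∀ {u v} i j → VD' u → VD' v → Ss i u → Ss j v → i ≢ j → ¬ DistLe G u v (2 * a)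
    separated i j u∈D v∈D u∈Sᵢ v∈Sⱼ i≢j u~v with midpoint a (a + 0) u~v
    ... | x , u~x , x~v =
      disjoint i j i≢j x (ball-inside i u∈D u∈Sᵢ x u~x)
        (ball-inside j v∈D v∈Sⱼ x (DistLe-sym (subst (DistLe G x _) (+-identityʳ a) x~v)))

    core : ∀ {v} → VD' v → S v → Σ (Fin k) λ i → Ss i v
    core {v} v∈D (w , (i , w∈Sᵢ) , v~w) with alternative v v∈D
    ... | inj₁ (j , within) = j , within v (centre v)
    ... | inj₂ misses       = ⊥-elim (misses w v~w i w∈Sᵢ)

    N-upper : ∀ m ms → IsN G a VD' S m → (∀ i → IsN G a VD' (Ss i) (ms i)) → m ≤ sumFin k ms
    N-upper m ms ((Y , packY , ∣Y∣≡m) , _) Nᵢ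
      with classify Ss Y (λ {v} v∈Y → let v∈S , v∈D = proj₁ packY v v∈Y in core v∈D v∈S)
    ... | Ys , cover , Ys⊆Y , sorted = begin
      m                          ≡⟨ sym ∣Y∣≡m ⟩
      ∣ Y ∣                      ≤⟨ cover-bound k Y Ys cover ⟩
      sumFin k (λ i → ∣ Ys i ∣)  ≤⟨ sumFin-mono k (λ i → proj₂ (Nᵢ i) (Ys i) (packing-restrict G {a = a} packY (Ys⊆Y i) (sorted i))) ⟩
      sumFin k ms                ∎
      where open ≤-Reasoning

    N-lower : ∀ m ms → IsN G a VD' S m → (∀ i → IsN G a VD' (Ss i) (ms i)) → sumFin k ms ≤ m
    N-lower m ms (_ , maximal) Nᵢ = begin
      sumFin k ms                ≡⟨ sumFin-cong k (λ i → sym (proj₂ (proj₂ (proj₁ (Nᵢ i))))) ⟩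
      sumFin k (λ i → ∣ Zs i ∣)  ≡⟨ sym (⋃ᶠ-additive k Zs Zs-disjoint) ⟩
      ∣ ⋃ᶠ Zs ∣                  ≤⟨ maximal (⋃ᶠ Zs) (inZ , farZ) ⟩
      m                          ∎
      where
      open ≤-Reasoning
      Zs : Fin k → Subset n
      Zs i = proj₁ (proj₁ (Nᵢ i))
      packZ : ∀ i → Packing G a VD' (Ss i) (Zs i)
      packZ i = proj₁ (proj₂ (proj₁ (Nᵢ i)))
      Zs-disjoint : Disjoint Zs
      Zs-disjoint i j {v} v∈Zᵢ v∈Zⱼ with i ≟ j
      ... | yes i≡j = i≡j
      ... | no  i≢j = ⊥-elim (disjoint i j i≢j v (proj₁ (proj₁ (packZ i) v v∈Zᵢ)) (proj₁ (proj₁ (packZ j) v v∈Zⱼ)))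
      inZ : ∀ v → v ∈ ⋃ᶠ Zs → S v × VD' v
      inZ v v∈Z = let i , v∈Zᵢ = ∈⋃ᶠ⁻ Zs v∈Z
                      v∈Sᵢ , v∈D = proj₁ (packZ i) v v∈Zᵢ
                  in Sᵢ⊆S i v∈Sᵢ , v∈D
      farZ : ∀ u v → u ∈ ⋃ᶠ Zs → v ∈ ⋃ᶠ Zs → ¬ (u ≡ v) → ¬ DistLe G u v (2 * a)
      farZ u v u∈Z v∈Z u≢v with ∈⋃ᶠ⁻ Zs u∈Z | ∈⋃ᶠ⁻ Zs v∈Z
      ... | i , u∈Zᵢ | j , v∈Zⱼ with i ≟ j
      ...   | yes refl = proj₂ (packZ i) u v u∈Zᵢ v∈Zⱼ u≢v
      ...   | no  i≢j  =
        let u∈Sᵢ , u∈D = proj₁ (packZ i) u u∈Zᵢ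
            v∈Sⱼ , v∈D = proj₁ (packZ j) v v∈Zⱼ
        in separated i j u∈D v∈D u∈Sᵢ v∈Sⱼ i≢j

    packing-number : ∀ m ms → IsN G a VD' S m → (∀ i → IsN G a VD' (Ss i) (ms i)) → m ≡ sumFin k ms
    packing-number m ms N Nᵢ = ≤-antisym (N-upper m ms N Nᵢ) (N-lower m ms N Nᵢ)

lemma18 : ∀ {n} (G : Graph n) (a : ℕ) → 1 ≤ a → (VD' : VSet n)
    → (k : ℕ) (Ss : Fin k → VSet n)
    → (∀ i j → ¬ (i ≡ j) → ∀ v → Ss i v → Ss j v → ⊥)
    → (∀ u → VD' u →
         (Σ (Fin k) λ i → ∀ w → Ball G a u w → Ss i w)
         ⊎ (∀ w → Ball G a u w → ∀ i → ¬ Ss i w))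
    → ConnectedInduced G (λ v → DistSetLe G v (λ w → Σ (Fin k) λ i → Ss i w) a)
    → (∀ (m : ℕ) (ms : Fin k → ℕ)
         → IsN G a VD' (λ v → DistSetLe G v (λ w → Σ (Fin k) λ i → Ss i w) a) m
         → (∀ i → IsN G a VD' (Ss i) (ms i))
         → m ≡ sumFin k ms)
      × (∀ (ds : Fin k → ℕ)
         → (∀ i → DiamLe G (Ss i) (ds i))
         → DiamLe G (λ v → DistSetLe G v (λ w → Σ (Fin k) λ i → Ss i w) a)
             (sumFin k (λ i → ds i + 2 * a + 1) ∸ 1))
lemma18 G a _ VD' k Ss disjoint alternative connected =
  packing-number , (λ ds diam → diameter ds diam connected)
  where
  open Neighbourhood G a k Ss
  open Packings VD' disjoint alternative
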